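{- Let $p>3$ be a prime, $\Delta$ a nonsquare in $\mathbb{F}_p$ (so $\mathbb{F}_{p^2}=\mathbb{F}_p(\sqrt{\Delta})$), $C_{2,\Delta}(s)=9(1+s\sqrt{\Delta})$, and for $s\in\mathbb{F}_p$ let $\mathcal{E}_{2,\Delta,s}: y^2=x^3+2(C_{2,\Delta}(s)-24)x-8(C_{2,\Delta}(s)-16)$ over $\mathbb{F}_{p^2}$. Then, as $s$ ranges over $\mathbb{F}_p$, the curves $\mathcal{E}_{2,\Delta,s}$ include at least $p-3$ pairwise non-isomorphic curves, and, counting also their quadratic twists over $\mathbb{F}_{p^2}$, at least $2p-6$ pairwise non-$\mathbb{F}_{p^2}$-isomorphic curves (each equipped with the degree-$2p$ endomorphism $\psi_{2,\Delta,s}$ or its twist).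
   Context: $\psi_{2,\Delta,s}$ denotes the endomorphism $(x,y)\mapsto\left(\frac{ -x^p}{2}-\frac{C_{2,\Delta}(s)^p}{x^p-4},\ \frac{y^p}{\sqrt{ -2}}\left(\frac{ -1}{2}+\frac{C_{2,\Delta}(s)^p}{(x^p-4)^2}\right)\right)$ of $\mathcal{E}_{2,\Delta,s}$. The quadratic twist of a curve over $\mathbb{F}_{p^2}$ is its twist by a nonsquare of $\mathbb{F}_{p^2}$. -}

module Defs where

open import Data.Nat using (ℕ)
open import Data.Integer using (ℤ; +_; _+_; _-_; _*_; -_)
open import Data.Integer.Divisibility using (_∣_)
open import Data.Fin using (Fin; toℕ)
open import Data.Bool using (Bool; true; false)
open import Data.Product using (_×_; _,_; ∃)
open import Relation.Nullary using (¬_)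

-- F_p is modelled by ℤ modulo p; F_{p^2} = F_p(√Δ) by pairs (a , b) ↦ a + b√Δ
-- of integers, with equality componentwise modulo p.
F₂ : Set
F₂ = ℤ × ℤ

_≈[_]_ : F₂ → ℕ → F₂ → Set
(a , b) ≈[ p ] (c , d) = ((+ p) ∣ (a - c)) × ((+ p) ∣ (b - d))

add : F₂ → F₂ → F₂
add (a , b) (c , d) = (a + c , b + d)

sub : F₂ → F₂ → F₂
sub (a , b) (c , d) = (a - c , b - d)

mul : ℤ → F₂ → F₂ → F₂
mul Δ (a , b) (c , d) = (a * c + Δ * (b * d) , a * d + b * c)

const : ℤ → F₂
const n = (n , + 0)

sqrtΔ : F₂
sqrtΔ = (+ 0 , + 1)

pow : ℤ → F₂ → ℕ → F₂
pow Δ x ℕ.zero = const (+ 1)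
pow Δ x (ℕ.suc n) = mul Δ x (pow Δ x n)

NonsquareFp : ℕ → ℤ → Set
NonsquareFp p Δ = ¬ ∃ λ (x : ℤ) → (+ p) ∣ (x * x - Δ)

NonsquareFp² : ℕ → ℤ → F₂ → Set
NonsquareFp² p Δ d = ¬ ∃ λ (x : F₂) → mul Δ x x ≈[ p ] d

-- A short Weierstrass curve y² = x³ + A x + B, given by (A , B)
Curve : Set
Curve = F₂ × F₂

-- F_{p^2}-isomorphism of short Weierstrass curves (p > 3):
-- (A , B) ≅ (A' , B') iff A' = u⁴ A and B' = u⁶ B for some u ≠ 0 in F_{p^2}
Iso : ℕ → ℤ → Curve → Curve → Set
Iso p Δ (A , B) (A' , B') =
  ∃ λ (u : F₂) → (¬ (u ≈[ p ] const (+ 0)))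
    × (A' ≈[ p ] mul Δ (pow Δ u 4) A)
    × (B' ≈[ p ] mul Δ (pow Δ u 6) B)

twist : ℤ → F₂ → Curve → Curve
twist Δ d (A , B) = (mul Δ (pow Δ d 2) A , mul Δ (pow Δ d 3) B)

C₂ : ℤ → ℤ → F₂
C₂ Δ s = mul Δ (const (+ 9)) (add (const (+ 1)) (mul Δ (const s) sqrtΔ))

E₂ : ℤ → ℤ → Curve
E₂ Δ s = ( mul Δ (const (+ 2)) (sub (C₂ Δ s) (const (+ 24)))
         , mul Δ (const (- (+ 8))) (sub (C₂ Δ s) (const (+ 16))) )

E₂F : ℤ → {p : ℕ} → Fin p → Curve
E₂F Δ s = E₂ Δ (+ toℕ s)

E₂± : ℤ → F₂ → {p : ℕ} → Fin p × Bool → Curve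
E₂± Δ d (s , false) = E₂F Δ s
E₂± Δ d (s , true) = twist Δ d (E₂F Δ s)

-- Isomorphic curves have equal j-invariants, and a quadratic twist does not change j.  For two
-- members s ≠ t of the family, equality of j-invariants amounts (after cancelling units and t − s)
-- to (s + t)(65 − 63Δst) = 0 together with a quartic equation Q(s, t) = 0.  Because Δ is not a
-- square, the branch s + t = 0 forces 81Δs² + 175 = 0, and the branch 63Δst = 65 fixes st and
-- (s + t)²; so s or t is ±e₁ or ±e₂ for two values fixed in advance, and in the first branch the sign
-- can be moved to the other member.  Removing e₁, e₂ and −e₂ leaves p − 3 members with distinct
-- j-invariants.  If A, B ≠ 0, an isomorphism between a curve and its twist by d forces u⁴ = d² and
-- u⁶ = d³, hence d = u²; for a nonsquare d the twists therefore double the count to 2p − 6.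
module Submission where

open import Defs
open import Algebra.Bundles using (CommutativeRing; Semiring)
open import Data.Bool.Base using (Bool; true; false)
open import Data.Empty using (⊥-elim)
open import Data.Fin.Base as Fin using (Fin; toℕ)
import Data.Fin.Properties as Finₚ
open import Data.Integer.Base as Int using (ℤ; +_; -[1+_]; ∣_∣)
import Data.Integer.Properties as ℤₚ
open import Data.Integer.Divisibility.Signed as Signed using (_∣_; _∣?_; divides)
open import Data.Integer.Tactic.RingSolver using (solve-∀)
import Data.Integer.Tactic.RingSolver as ℤ-Solver
open import Data.Nat.Base as ℕ using (ℕ; zero; suc; _<_; _∸_)
open import Data.Nat.Coprimality using (Coprime; coprime-Bézout)
import Data.Nat.Divisibility as ℕ∣
open import Data.Nat.GCD using (module Bézout)
open import Data.Nat.Primality using (Prime; euclidsLemma; prime⇒irreducible; prime⇒nonTrivial)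
import Data.Nat.Properties as ℕₚ
open import Data.Product.Base as Prod using (_×_; _,_; ∃; proj₁; proj₂)
open import Data.Product.Properties using (×-≡,≡→≡)
open import Data.Sum.Base as Sum using (_⊎_; inj₁; inj₂; [_,_]′)
open import Function.Base using (id; _∘_)
open import Function.Definitions using (Injective)
open import Level using (0ℓ; _⊔_)
open import Relation.Binary.PropositionalEquality using (_≡_; _≢_; refl; sym; trans; cong; subst; subst₂; module ≡-Reasoning)
open import Relation.Binary.Structures using (IsEquivalence)
open import Relation.Nullary using (¬_; Dec; yes; no; _×-dec_)
open import Relation.Nullary.Decidable using (decidable-stable)
open import Relation.Unary using (Decidable)
import Tactic.RingSolver.NonReflective

module ℤ-Syntax = Tactic.RingSolver.NonReflective ℤ-Solver.ring

AtMostOne : ∀ {a ℓ} {A : Set a} → (A → Set ℓ) → Set (a ⊔ ℓ)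
AtMostOne P = ∀ {x y} → P x → P y → x ≡ y

avoid₁ : ∀ {ℓ n} {P : Fin (suc n) → Set ℓ} → Decidable P → AtMostOne P →
         ∃ λ (f : Fin n → Fin (suc n)) → Injective _≡_ _≡_ f × ∀ i → ¬ P (f i)
avoid₁ {P = P} P? unique = embedding (Finₚ.any? P?)
  where
  embedding : Dec (∃ P) → ∃ λ f → Injective _≡_ _≡_ f × ∀ i → ¬ P (f i)
  embedding (yes (x , Px)) = Fin.punchIn x , Finₚ.punchIn-injective x _ _ , λ i P[fi] → Finₚ.punchInᵢ≢i x i (unique P[fi] Px)
  embedding (no none) = Fin.inject₁ , Finₚ.inject₁-injective , λ i P[fi] → none (_ , P[fi])

avoid₃ : ∀ {ℓ n} {P Q R : Fin n → Set ℓ} → Decidable P → Decidable Q → Decidable R →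
         AtMostOne P → AtMostOne Q → AtMostOne R →
         ∃ λ (f : Fin (n ∸ 3) → Fin n) → Injective _≡_ _≡_ f × ∀ i → ¬ (P (f i) ⊎ Q (f i) ⊎ R (f i))
avoid₃ {n = 0} _ _ _ _ _ _ = (λ ()) , (λ { {()} }) , λ ()
avoid₃ {n = 1} _ _ _ _ _ _ = (λ ()) , (λ { {()} }) , λ ()
avoid₃ {n = 2} _ _ _ _ _ _ = (λ ()) , (λ { {()} }) , λ ()
avoid₃ {n = suc (suc (suc n))} P? Q? R? P! Q! R! with avoid₁ P? P!
... | f₁ , f₁-injective , ¬P with avoid₁ (λ i → Q? (f₁ i)) (λ q q′ → f₁-injective (Q! q q′))
... | f₂ , f₂-injective , ¬Q with avoid₁ (λ i → R? (f₁ (f₂ i))) (λ r r′ → f₂-injective (f₁-injective (R! r r′)))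
... | f₃ , f₃-injective , ¬R =
  f₁ ∘ f₂ ∘ f₃ , (λ eq → f₃-injective (f₂-injective (f₁-injective eq))) , λ i → [ ¬P (f₂ (f₃ i)) , [ ¬Q (f₃ i) , ¬R i ]′ ]′

tag : ∀ {k} → Fin k ⊎ Fin k → Fin k × Bool
tag (inj₁ i) = i , false
tag (inj₂ i) = i , true

tag-injective : ∀ {k} → Injective _≡_ _≡_ (tag {k})
tag-injective {x = inj₁ i} {inj₁ j} refl = refl
tag-injective {x = inj₂ i} {inj₂ j} refl = refl

tagged : ∀ {m k} → m ≡ k ℕ.+ k → Fin m → Fin k × Bool
tagged {k = k} m≡k+k i = tag (Fin.splitAt k (Fin.cast m≡k+k i))

tagged-injective : ∀ {m k} (m≡k+k : m ≡ k ℕ.+ k) → Injective _≡_ _≡_ (tagged m≡k+k)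
tagged-injective {k = k} m≡k+k {i} {j} eq = cast-injective (splitAt-injective (tag-injective eq))
  where
  splitAt-injective : ∀ {x y} → Fin.splitAt k x ≡ Fin.splitAt k y → x ≡ y
  splitAt-injective {x} {y} h = trans (sym (Finₚ.join-splitAt k k x)) (trans (cong (Fin.join k k) h) (Finₚ.join-splitAt k k y))
  cast-injective : Fin.cast m≡k+k i ≡ Fin.cast m≡k+k j → i ≡ j
  cast-injective h = Finₚ.toℕ-injective (trans (sym (Finₚ.toℕ-cast m≡k+k i)) (trans (cong toℕ h) (Finₚ.toℕ-cast m≡k+k j)))

2*n∸6≡n∸3+n∸3 : ∀ n → 2 ℕ.* n ∸ 6 ≡ (n ∸ 3) ℕ.+ (n ∸ 3)
2*n∸6≡n∸3+n∸3 n = trans (sym (ℕₚ.*-distribˡ-∸ 2 n 3)) (cong ((n ∸ 3) ℕ.+_) (ℕₚ.+-identityʳ (n ∸ 3)))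

module ShortWeierstrass {c ℓ} (R : CommutativeRing c ℓ) where

  open CommutativeRing R renaming (refl to ≈-refl; sym to ≈-sym; trans to ≈-trans)
  open import Algebra.Definitions.RawSemiring (Semiring.rawSemiring semiring) public using (_^_)
  open import Algebra.Properties.Semiring.Exp semiring using (^-congˡ)
  open import Algebra.Properties.Group +-group using (x∙y⁻¹≈ε⇒x≈y)
  open import Algebra.Properties.Ring ring using (-‿distribʳ-*)
  open import Algebra.Solver.CommutativeMonoid *-commutativeMonoid using (Expr; _⊕_; _⊜_; solve) renaming (id to 1ᵉ)
  open import Relation.Binary.Reasoning.Setoid setoid

  infixr 8 _^ᵉ_
  _^ᵉ_ : ∀ {n} → Expr n → ℕ → Expr n
  e ^ᵉ zero = 1ᵉ
  e ^ᵉ suc k = e ⊕ e ^ᵉ k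

  Model : Set c
  Model = Carrier × Carrier

  infix 4 _≅_
  _≅_ : Model → Model → Set (c ⊔ ℓ)
  (A , B) ≅ (A′ , B′) = ∃ λ u → u ≉ 0# × A′ ≈ u ^ 4 * A × B′ ≈ u ^ 6 * B

  -- Equality of j = 1728 · 4A³ / (4A³ + 27B²), cross-multiplied.
  SameJ : Model → Model → Set ℓ
  SameJ (A , B) (A′ , B′) = A′ ^ 3 * B ^ 2 ≈ A ^ 3 * B′ ^ 2

  quadraticTwist : Carrier → Model → Model
  quadraticTwist d (A , B) = (d ^ 2 * A , d ^ 3 * B)

  twistIf : Bool → Carrier → Model → Model
  twistIf false d E = E
  twistIf true d E = quadraticTwist d E

  IsSquare : Carrier → Set (c ⊔ ℓ)
  IsSquare d = ∃ λ x → x * x ≈ d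

  ≅⇒sameJ : ∀ {E E′} → E ≅ E′ → SameJ E E′
  ≅⇒sameJ {A , B} {A′ , B′} (u , _ , A′≈ , B′≈) = begin
    A′ ^ 3 * B ^ 2              ≈⟨ *-congʳ (^-congˡ 3 A′≈) ⟩
    (u ^ 4 * A) ^ 3 * B ^ 2     ≈⟨ solve 3 (λ u A B → (u ^ᵉ 4 ⊕ A) ^ᵉ 3 ⊕ B ^ᵉ 2 ⊜ A ^ᵉ 3 ⊕ (u ^ᵉ 6 ⊕ B) ^ᵉ 2) ≈-refl u A B ⟩
    A ^ 3 * (u ^ 6 * B) ^ 2     ≈⟨ *-congˡ (^-congˡ 2 B′≈) ⟨
    A ^ 3 * B′ ^ 2              ∎

  nonsquare⇒nonzero : ∀ {d} → ¬ IsSquare d → d ≉ 0#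
  nonsquare⇒nonzero ¬□ d≈0 = ¬□ (0# , ≈-trans (zeroˡ 0#) (≈-sym d≈0))

  module IntegralDomain (no-zero-divisors : ∀ {x y} → x ≉ 0# → x * y ≈ 0# → y ≈ 0#) where

    *-cancelˡ : ∀ {x y z} → x ≉ 0# → x * y ≈ x * z → y ≈ z
    *-cancelˡ {x} {y} {z} x≉0 xy≈xz = x∙y⁻¹≈ε⇒x≈y y z (no-zero-divisors x≉0 (begin
      x * (y - z)        ≈⟨ distribˡ x y (- z) ⟩
      x * y + x * (- z)  ≈⟨ +-cong xy≈xz (≈-sym (-‿distribʳ-* x z)) ⟩
      x * z - x * z      ≈⟨ -‿inverseʳ (x * z) ⟩
      0#                 ∎))

    *-cancelʳ : ∀ {x y z} → x ≉ 0# → y * x ≈ z * x → y ≈ z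
    *-cancelʳ {x} {y} {z} x≉0 yx≈zx = *-cancelˡ x≉0 (≈-trans (*-comm x y) (≈-trans yx≈zx (*-comm z x)))

    *-nonzero : ∀ {x y} → x ≉ 0# → y ≉ 0# → x * y ≉ 0#
    *-nonzero x≉0 y≉0 xy≈0 = y≉0 (no-zero-divisors x≉0 xy≈0)

    ^-nonzero : ∀ {x} → x ≉ 0# → ∀ n → x ^ n ≉ 0#
    ^-nonzero {x} x≉0 zero 1≈0 = x≉0 (begin
      x       ≈⟨ *-identityʳ x ⟨
      x * 1#  ≈⟨ *-congˡ 1≈0 ⟩
      x * 0#  ≈⟨ zeroʳ x ⟩
      0#      ∎)
    ^-nonzero x≉0 (suc n) = *-nonzero x≉0 (^-nonzero x≉0 n)

    sameJ-twistˡ : ∀ {d E E′} → d ≉ 0# → SameJ (quadraticTwist d E) E′ → SameJ E E′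
    sameJ-twistˡ {d} {A , B} {A′ , B′} d≉0 h = *-cancelˡ (^-nonzero d≉0 6) (begin
      d ^ 6 * (A′ ^ 3 * B ^ 2)   ≈⟨ solve 3 (λ d A′ B → d ^ᵉ 6 ⊕ A′ ^ᵉ 3 ⊕ B ^ᵉ 2 ⊜ A′ ^ᵉ 3 ⊕ (d ^ᵉ 3 ⊕ B) ^ᵉ 2) ≈-refl d A′ B ⟩
      A′ ^ 3 * (d ^ 3 * B) ^ 2   ≈⟨ h ⟩
      (d ^ 2 * A) ^ 3 * B′ ^ 2   ≈⟨ solve 3 (λ d A B′ → (d ^ᵉ 2 ⊕ A) ^ᵉ 3 ⊕ B′ ^ᵉ 2 ⊜ d ^ᵉ 6 ⊕ A ^ᵉ 3 ⊕ B′ ^ᵉ 2) ≈-refl d A B′ ⟩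
      d ^ 6 * (A ^ 3 * B′ ^ 2)   ∎)

    sameJ-twistʳ : ∀ {d E E′} → d ≉ 0# → SameJ E (quadraticTwist d E′) → SameJ E E′
    sameJ-twistʳ {d} {A , B} {A′ , B′} d≉0 h = *-cancelˡ (^-nonzero d≉0 6) (begin
      d ^ 6 * (A′ ^ 3 * B ^ 2)   ≈⟨ solve 3 (λ d A′ B → d ^ᵉ 6 ⊕ A′ ^ᵉ 3 ⊕ B ^ᵉ 2 ⊜ (d ^ᵉ 2 ⊕ A′) ^ᵉ 3 ⊕ B ^ᵉ 2) ≈-refl d A′ B ⟩
      (d ^ 2 * A′) ^ 3 * B ^ 2   ≈⟨ h ⟩
      A ^ 3 * (d ^ 3 * B′) ^ 2   ≈⟨ solve 3 (λ d A B′ → A ^ᵉ 3 ⊕ (d ^ᵉ 3 ⊕ B′) ^ᵉ 2 ⊜ d ^ᵉ 6 ⊕ A ^ᵉ 3 ⊕ B′ ^ᵉ 2) ≈-refl d A B′ ⟩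
      d ^ 6 * (A ^ 3 * B′ ^ 2)   ∎)

    sameJ-untwist : ∀ {d} β β′ {E E′} → d ≉ 0# → SameJ (twistIf β d E) (twistIf β′ d E′) → SameJ E E′
    sameJ-untwist false false d≉0 h = h
    sameJ-untwist false true  d≉0 h = sameJ-twistʳ d≉0 h
    sameJ-untwist true  false d≉0 h = sameJ-twistˡ d≉0 h
    sameJ-untwist true  true  d≉0 h = sameJ-twistˡ d≉0 (sameJ-twistʳ d≉0 h)

    square-cube-cancel : ∀ {x y} → y ≉ 0# → x ^ 2 ≈ y ^ 2 → x ^ 3 ≈ y ^ 3 → x ≈ y
    square-cube-cancel {x} {y} y≉0 x²≈y² x³≈y³ = *-cancelˡ (^-nonzero y≉0 2) (begin
      y ^ 2 * x   ≈⟨ *-congʳ x²≈y² ⟨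
      x ^ 2 * x   ≈⟨ solve 1 (λ x → x ^ᵉ 2 ⊕ x ⊜ x ^ᵉ 3) ≈-refl x ⟩
      x ^ 3       ≈⟨ x³≈y³ ⟩
      y ^ 3       ≈⟨ solve 1 (λ y → y ^ᵉ 3 ⊜ y ^ᵉ 2 ⊕ y) ≈-refl y ⟩
      y ^ 2 * y   ∎)

    ≅-twist⇒square : ∀ {d A B} → d ≉ 0# → A ≉ 0# → B ≉ 0# → (A , B) ≅ quadraticTwist d (A , B) → IsSquare d
    ≅-twist⇒square {d} {A} {B} d≉0 A≉0 B≉0 (u , _ , hA , hB) = u , (begin
      u * u   ≈⟨ solve 1 (λ u → u ⊕ u ⊜ u ^ᵉ 2) ≈-refl u ⟩
      u ^ 2   ≈⟨ square-cube-cancel d≉0 (≈-trans (solve 1 (λ u → (u ^ᵉ 2) ^ᵉ 2 ⊜ u ^ᵉ 4) ≈-refl u) (≈-sym (*-cancelʳ A≉0 hA)))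
                                          (≈-trans (solve 1 (λ u → (u ^ᵉ 2) ^ᵉ 3 ⊜ u ^ᵉ 6) ≈-refl u) (≈-sym (*-cancelʳ B≉0 hB))) ⟩
      d       ∎)

    twist-≅⇒square : ∀ {d A B} → d ≉ 0# → A ≉ 0# → B ≉ 0# → quadraticTwist d (A , B) ≅ (A , B) → IsSquare d
    twist-≅⇒square {d} {A} {B} d≉0 A≉0 B≉0 (u , _ , hA , hB) = d * u , (begin
      d * u * (d * u)   ≈⟨ solve 2 (λ d u → (d ⊕ u) ⊕ (d ⊕ u) ⊜ d ⊕ (u ^ᵉ 2 ⊕ d)) ≈-refl d u ⟩
      d * (u ^ 2 * d)   ≈⟨ *-congˡ u²d≈1 ⟩
      d * 1#            ≈⟨ *-identityʳ d ⟩
      d                 ∎)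
      where
      u²d≈1 : u ^ 2 * d ≈ 1#
      u²d≈1 = square-cube-cancel (^-nonzero d≉0 0)
        (*-cancelʳ A≉0 (≈-trans (solve 3 (λ u d A → (u ^ᵉ 2 ⊕ d) ^ᵉ 2 ⊕ A ⊜ u ^ᵉ 4 ⊕ d ^ᵉ 2 ⊕ A) ≈-refl u d A)
                                (≈-trans (≈-sym hA) (solve 1 (λ A → A ⊜ 1ᵉ ^ᵉ 2 ⊕ A) ≈-refl A))))
        (*-cancelʳ B≉0 (≈-trans (solve 3 (λ u d B → (u ^ᵉ 2 ⊕ d) ^ᵉ 3 ⊕ B ⊜ u ^ᵉ 6 ⊕ d ^ᵉ 3 ⊕ B) ≈-refl u d B)
                                (≈-trans (≈-sym hB) (solve 1 (λ B → B ⊜ 1ᵉ ^ᵉ 3 ⊕ B) ≈-refl B))))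

    twistIf-≅⇒≡ : ∀ {d A B} β β′ → ¬ IsSquare d → A ≉ 0# → B ≉ 0# → twistIf β d (A , B) ≅ twistIf β′ d (A , B) → β ≡ β′
    twistIf-≅⇒≡ false false ¬□ A≉0 B≉0 _ = refl
    twistIf-≅⇒≡ true  true  ¬□ A≉0 B≉0 _ = refl
    twistIf-≅⇒≡ false true  ¬□ A≉0 B≉0 i = ⊥-elim (¬□ (≅-twist⇒square (nonsquare⇒nonzero ¬□) A≉0 B≉0 i))
    twistIf-≅⇒≡ true  false ¬□ A≉0 B≉0 i = ⊥-elim (¬□ (twist-≅⇒square (nonsquare⇒nonzero ¬□) A≉0 B≉0 i))

module Modular (p : ℕ) where

  open Int using (-_; _+_; _-_; _*_)

  infix 4 p∣_ _≡ₚ_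

  p∣_ : ℤ → Set
  p∣ x = + p ∣ x

  p∣? : Decidable p∣_
  p∣? x = + p ∣? x

  p∣0 : p∣ + 0
  p∣0 = divides (+ 0) refl

  p∣p : p∣ + p
  p∣p = Signed.∣-refl

  p∣-+ : ∀ {x y} → p∣ x → p∣ y → p∣ (x + y)
  p∣-+ = Signed.∣m∣n⇒∣m+n

  p∣-- : ∀ {x y} → p∣ x → p∣ y → p∣ (x - y)
  p∣-- = Signed.∣m∣n⇒∣m-n

  p∣-neg : ∀ {x} → p∣ x → p∣ (- x)
  p∣-neg = Signed.∣m⇒∣-m

  p∣-*ˡ : ∀ x {y} → p∣ y → p∣ (x * y)
  p∣-*ˡ = Signed.∣n⇒∣m*n

  p∣-*ʳ : ∀ {x} y → p∣ x → p∣ (x * y)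
  p∣-*ʳ y = Signed.∣m⇒∣m*n y

  p∣-≡ : ∀ {x y} → x ≡ y → p∣ x → p∣ y
  p∣-≡ = subst p∣_

  -- A record rather than a synonym for p∣ (x - y), so that x and y can be inferred.
  record _≡ₚ_ (x y : ℤ) : Set where
    constructor ≡ₚ-intro
    field p∣-difference : p∣ (x - y)

  ≡⇒≡ₚ : ∀ {x y} → x ≡ y → x ≡ₚ y
  ≡⇒≡ₚ {x} refl = ≡ₚ-intro (p∣-≡ (sym (ℤₚ.+-inverseʳ x)) p∣0)

  p∣⇒≡ₚ0 : ∀ {x} → p∣ x → x ≡ₚ + 0
  p∣⇒≡ₚ0 {x} h = ≡ₚ-intro (p∣-≡ (sym (ℤₚ.+-identityʳ x)) h)

  ≡ₚ0⇒p∣ : ∀ {x} → x ≡ₚ + 0 → p∣ x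
  ≡ₚ0⇒p∣ {x} (≡ₚ-intro h) = p∣-≡ (ℤₚ.+-identityʳ x) h

  ≡ₚ-refl : ∀ {x} → x ≡ₚ x
  ≡ₚ-refl = ≡⇒≡ₚ refl

  ≡ₚ-sym : ∀ {x y} → x ≡ₚ y → y ≡ₚ x
  ≡ₚ-sym {x} {y} (≡ₚ-intro h) = ≡ₚ-intro (p∣-≡ (flip x y) (p∣-neg h))
    where
    flip : ∀ x y → - (x - y) ≡ y - x
    flip = solve-∀

  ≡ₚ-trans : ∀ {x y z} → x ≡ₚ y → y ≡ₚ z → x ≡ₚ z
  ≡ₚ-trans {x} {y} {z} (≡ₚ-intro h) (≡ₚ-intro k) = ≡ₚ-intro (p∣-≡ (telescope x y z) (p∣-+ h k))
    where
    telescope : ∀ x y z → (x - y) + (y - z) ≡ x - z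
    telescope = solve-∀

  +-congₚ : ∀ {x x′ y y′} → x ≡ₚ x′ → y ≡ₚ y′ → x + y ≡ₚ x′ + y′
  +-congₚ {x} {x′} {y} {y′} (≡ₚ-intro h) (≡ₚ-intro k) = ≡ₚ-intro (p∣-≡ (regroup x x′ y y′) (p∣-+ h k))
    where
    regroup : ∀ x x′ y y′ → (x - x′) + (y - y′) ≡ (x + y) - (x′ + y′)
    regroup = solve-∀

  *-congₚ : ∀ {x x′ y y′} → x ≡ₚ x′ → y ≡ₚ y′ → x * y ≡ₚ x′ * y′
  *-congₚ {x} {x′} {y} {y′} (≡ₚ-intro h) (≡ₚ-intro k) =
    ≡ₚ-intro (p∣-≡ (regroup x x′ y y′) (p∣-+ (p∣-*ʳ y h) (p∣-*ˡ x′ k)))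
    where
    regroup : ∀ x x′ y y′ → (x - x′) * y + x′ * (y - y′) ≡ x * y - x′ * y′
    regroup = solve-∀

  -‿congₚ : ∀ {x y} → x ≡ₚ y → - x ≡ₚ - y
  -‿congₚ {x} {y} (≡ₚ-intro h) = ≡ₚ-intro (p∣-≡ (regroup x y) (p∣-neg h))
    where
    regroup : ∀ x y → - (x - y) ≡ - x - - y
    regroup = solve-∀

module ModularPrime {p : ℕ} (p-prime : Prime p) where

  open Int using (-_; _+_; _-_; _*_; _^_)
  open Modular p public
  open ≡-Reasoning

  p∣-euclid : ∀ x y → p∣ (x * y) → p∣ x ⊎ p∣ y
  p∣-euclid x y h =
    Sum.map Signed.∣ᵤ⇒∣ Signed.∣ᵤ⇒∣ (euclidsLemma ∣ x ∣ ∣ y ∣ p-prime (subst (ℕ∣._∣_ p) (ℤₚ.abs-* x y) (Signed.∣⇒∣ᵤ h)))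

  p∤-* : ∀ {x y} → ¬ p∣ x → ¬ p∣ y → ¬ p∣ (x * y)
  p∤-* {x} {y} p∤x p∤y h = [ p∤x , p∤y ]′ (p∣-euclid x y h)

  p∣-cancelˡ : ∀ {x y} → ¬ p∣ x → p∣ (x * y) → p∣ y
  p∣-cancelˡ {x} {y} p∤x h = [ (λ p∣x → ⊥-elim (p∤x p∣x)) , id ]′ (p∣-euclid x y h)

  p∤-small : ∀ {n} → suc n < p → ¬ p∣ + suc n
  p∤-small n<p h = ℕ∣.>⇒∤ n<p (Signed.∣⇒∣ᵤ h)

  p∤1 : ¬ p∣ + 1
  p∤1 = p∤-small (ℕ.nonTrivial⇒n>1 p {{prime⇒nonTrivial p-prime}})

  p∤-^ : ∀ {x} → ¬ p∣ x → ∀ n → ¬ p∣ (x ^ n)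
  p∤-^ p∤x zero = p∤1
  p∤-^ p∤x (suc n) = p∤-* p∤x (p∤-^ p∤x n)

  residue-injective : ∀ {s t} → s < p → t < p → + s ≡ₚ + t → s ≡ t
  residue-injective {s} {t} s<p t<p (≡ₚ-intro h) =
    ℤₚ.+-injective (ℤₚ.i-j≡0⇒i≡j (+ s) (+ t) (ℤₚ.∣i∣≡0⇒i≡0 (multiple-below-p (Signed.∣⇒∣ᵤ h) distance<p)))
    where
    multiple-below-p : ∀ {d} → p ℕ∣.∣ d → d < p → d ≡ 0
    multiple-below-p {zero} _ _ = refl
    multiple-below-p {suc d} p∣d d<p = ⊥-elim (ℕ∣.>⇒∤ d<p p∣d)
    distance<p : ∣ + s - + t ∣ < p
    distance<p = subst (_< p) (cong ∣_∣ (sym (ℤₚ.m-n≡m⊖n s t))) (ℕₚ.≤-<-trans (ℤₚ.∣m⊝n∣≤m⊔n s t) (ℕₚ.⊔-lub s<p t<p))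

  toℕ-residue-injective : ∀ (s t : Fin p) → + toℕ s ≡ₚ + toℕ t → s ≡ t
  toℕ-residue-injective s t h = Finₚ.toℕ-injective (residue-injective (Finₚ.toℕ<n s) (Finₚ.toℕ<n t) h)

  p∤⇒coprime : ∀ {n} → ¬ p ℕ∣.∣ n → Coprime p n
  p∤⇒coprime p∤n (d∣p , d∣n) with prime⇒irreducible p-prime d∣p
  ... | inj₁ d≡1 = d≡1
  ... | inj₂ refl = ⊥-elim (p∤n d∣n)

  lift-identity : ∀ a b c d e → a ℕ.+ b ℕ.* c ≡ d ℕ.* e → + a + + b * + c ≡ + d * + e
  lift-identity a b c d e eq = begin
    + a + + b * + c     ≡⟨ cong (_+_ (+ a)) (ℤₚ.pos-* b c) ⟨
    + a + + (b ℕ.* c)   ≡⟨ ℤₚ.pos-+ a (b ℕ.* c) ⟨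
    + (a ℕ.+ b ℕ.* c)   ≡⟨ cong +_ eq ⟩
    + (d ℕ.* e)         ≡⟨ ℤₚ.pos-* d e ⟩
    + d * + e           ∎

  inverseℕ : ∀ {n} → ¬ p ℕ∣.∣ n → ∃ λ m → p∣ (+ n * m - + 1)
  inverseℕ {n} p∤n with coprime-Bézout (p∤⇒coprime p∤n)
  ... | Bézout.+- x y eq = - + y , p∣-≡ (begin
      - (+ x * + p)         ≡⟨ cong -_ (lift-identity 1 y n x p eq) ⟨
      - (+ 1 + + y * + n)   ≡⟨ rearrange (+ n) (+ y) ⟩
      + n * - + y - + 1     ∎) (p∣-neg (p∣-*ˡ (+ x) p∣p))
    where
    rearrange : ∀ k l → - (+ 1 + l * k) ≡ k * - l - + 1
    rearrange = solve-∀
  ... | Bézout.-+ x y eq = + y , p∣-≡ (begin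
      + x * + p               ≡⟨ rearrange (+ x * + p) ⟨
      (+ 1 + + x * + p) - + 1 ≡⟨ cong (_- + 1) (lift-identity 1 x p y n eq) ⟩
      + y * + n - + 1         ≡⟨ cong (_- + 1) (ℤₚ.*-comm (+ y) (+ n)) ⟩
      + n * + y - + 1         ∎) (p∣-*ˡ (+ x) p∣p)
    where
    rearrange : ∀ m → (+ 1 + m) - + 1 ≡ m
    rearrange = solve-∀

  inverse : ∀ {b} → ¬ p∣ b → ∃ λ m → p∣ (b * m - + 1)
  inverse {+ n} p∤b = inverseℕ (λ h → p∤b (Signed.∣ᵤ⇒∣ h))
  inverse { -[1+ n ]} p∤b with inverseℕ {suc n} (λ h → p∤b (Signed.∣ᵤ⇒∣ h))
  ... | m , h = - m , p∣-≡ (sign-flip (+ suc n) m) h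
    where
    sign-flip : ∀ k m → k * m - + 1 ≡ - k * - m - + 1
    sign-flip = solve-∀

module QuadraticExtension (p : ℕ) (Δ : ℤ) where

  open Int using (-_; _+_; _-_; _*_)
  open Modular p

  neg : F₂ → F₂
  neg (a , b) = (- a , - b)

  infix 4 _≋_
  record _≋_ (x y : F₂) : Set where
    constructor _,_
    field
      re : proj₁ x ≡ₚ proj₁ y
      im : proj₂ x ≡ₚ proj₂ y

  componentwise : ∀ {x y} → proj₁ x ≡ proj₁ y → proj₂ x ≡ proj₂ y → x ≋ y
  componentwise h k = ≡⇒≡ₚ h , ≡⇒≡ₚ k

  ≈[]⇒≋ : ∀ {x y} → x ≈[ p ] y → x ≋ y
  ≈[]⇒≋ (h , k) = ≡ₚ-intro (Signed.∣ᵤ⇒∣ h) , ≡ₚ-intro (Signed.∣ᵤ⇒∣ k)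

  ≋⇒≈[] : ∀ {x y} → x ≋ y → x ≈[ p ] y
  ≋⇒≈[] (≡ₚ-intro h , ≡ₚ-intro k) = Signed.∣⇒∣ᵤ h , Signed.∣⇒∣ᵤ k

  ring : CommutativeRing 0ℓ 0ℓ
  ring = record
    { Carrier = F₂ ; _≈_ = _≋_ ; _+_ = add ; _*_ = mul Δ ; -_ = neg ; 0# = const (+ 0) ; 1# = const (+ 1)
    ; isCommutativeRing = record
      { isRing = record
        { +-isAbelianGroup = record
          { isGroup = record
            { isMonoid = record
              { isSemigroup = record
                { isMagma = record { isEquivalence = ≋-isEquivalence ; ∙-cong = +-cong }
                ; assoc = λ (a , b) (c , d) (e , f) → componentwise (ℤₚ.+-assoc a c e) (ℤₚ.+-assoc b d f) }
              ; identity = (λ (a , b) → componentwise (ℤₚ.+-identityˡ a) (ℤₚ.+-identityˡ b))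
                         , (λ (a , b) → componentwise (ℤₚ.+-identityʳ a) (ℤₚ.+-identityʳ b)) }
            ; inverse = (λ (a , b) → componentwise (ℤₚ.+-inverseˡ a) (ℤₚ.+-inverseˡ b))
                      , (λ (a , b) → componentwise (ℤₚ.+-inverseʳ a) (ℤₚ.+-inverseʳ b))
            ; ⁻¹-cong = λ (h , k) → -‿congₚ h , -‿congₚ k }
          ; comm = λ (a , b) (c , d) → componentwise (ℤₚ.+-comm a c) (ℤₚ.+-comm b d) }
        ; *-cong = *-cong
        ; *-assoc = *-assoc
        ; *-identity = *-identityˡ , λ x → ≋-trans (*-comm x _) (*-identityˡ x)
        ; distrib = *-distribˡ-+ , λ x y z → ≋-trans (*-comm (add y z) x) (≋-trans (*-distribˡ-+ x y z) (+-cong (*-comm x y) (*-comm x z))) }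
      ; *-comm = *-comm } }
    where
    ≋-isEquivalence : IsEquivalence _≋_
    ≋-isEquivalence = record
      { refl = ≡ₚ-refl , ≡ₚ-refl
      ; sym = λ (h , k) → ≡ₚ-sym h , ≡ₚ-sym k
      ; trans = λ (h , k) (h′ , k′) → ≡ₚ-trans h h′ , ≡ₚ-trans k k′ }
    ≋-trans : ∀ {x y z} → x ≋ y → y ≋ z → x ≋ z
    ≋-trans = IsEquivalence.trans ≋-isEquivalence
    +-cong : ∀ {x x′ y y′} → x ≋ x′ → y ≋ y′ → add x y ≋ add x′ y′
    +-cong (h , k) (h′ , k′) = +-congₚ h h′ , +-congₚ k k′
    *-cong : ∀ {x x′ y y′} → x ≋ x′ → y ≋ y′ → mul Δ x y ≋ mul Δ x′ y′
    *-cong (a≈ , b≈) (c≈ , d≈) =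
      +-congₚ (*-congₚ a≈ c≈) (*-congₚ (≡ₚ-refl {Δ}) (*-congₚ b≈ d≈)) , +-congₚ (*-congₚ a≈ d≈) (*-congₚ b≈ c≈)
    *-assoc : ∀ x y z → mul Δ (mul Δ x y) z ≋ mul Δ x (mul Δ y z)
    *-assoc (a , b) (c , d) (e , f) = componentwise (re Δ a b c d e f) (im Δ a b c d e f)
      where
      re : ∀ Δ a b c d e f → (a * c + Δ * (b * d)) * e + Δ * ((a * d + b * c) * f) ≡ a * (c * e + Δ * (d * f)) + Δ * (b * (c * f + d * e))
      re = solve-∀
      im : ∀ Δ a b c d e f → (a * c + Δ * (b * d)) * f + (a * d + b * c) * e ≡ a * (c * f + d * e) + b * (c * e + Δ * (d * f))
      im = solve-∀
    *-comm : ∀ x y → mul Δ x y ≋ mul Δ y x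
    *-comm (a , b) (c , d) = componentwise (re Δ a b c d) (im a b c d)
      where
      re : ∀ Δ a b c d → a * c + Δ * (b * d) ≡ c * a + Δ * (d * b)
      re = solve-∀
      im : ∀ a b c d → a * d + b * c ≡ c * b + d * a
      im = solve-∀
    *-identityˡ : ∀ x → mul Δ (const (+ 1)) x ≋ x
    *-identityˡ (a , b) = componentwise (re Δ a b) (im a b)
      where
      re : ∀ Δ a b → + 1 * a + Δ * (+ 0 * b) ≡ a
      re = solve-∀
      im : ∀ a b → + 1 * b + + 0 * a ≡ b
      im = solve-∀
    *-distribˡ-+ : ∀ x y z → mul Δ x (add y z) ≋ add (mul Δ x y) (mul Δ x z)
    *-distribˡ-+ (a , b) (c , d) (e , f) = componentwise (re Δ a b c d e f) (im a b c d e f)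
      where
      re : ∀ Δ a b c d e f → a * (c + e) + Δ * (b * (d + f)) ≡ (a * c + Δ * (b * d)) + (a * e + Δ * (b * f))
      re = solve-∀
      im : ∀ a b c d e f → a * (d + f) + b * (c + e) ≡ (a * d + b * c) + (a * f + b * e)
      im = solve-∀

  open ShortWeierstrass ring public

  pow≡^ : ∀ u n → pow Δ u n ≡ u ^ n
  pow≡^ u zero = refl
  pow≡^ u (suc n) = cong (mul Δ u) (pow≡^ u n)

  iso⇒≅ : ∀ {E E′} → Iso p Δ E E′ → E ≅ E′
  iso⇒≅ {A , B} {A′ , B′} (u , u≢0 , A′≈ , B′≈) =
    u , (λ u≈0 → u≢0 (≋⇒≈[] u≈0)) ,
    subst (λ v → A′ ≋ mul Δ v A) (pow≡^ u 4) (≈[]⇒≋ A′≈) , subst (λ v → B′ ≋ mul Δ v B) (pow≡^ u 6) (≈[]⇒≋ B′≈)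

  nonsquare⇒¬IsSquare : ∀ {d} → NonsquareFp² p Δ d → ¬ IsSquare d
  nonsquare⇒¬IsSquare d-nonsquare (x , x²≈d) = d-nonsquare (x , ≋⇒≈[] x²≈d)

module QuadraticField {p : ℕ} (p-prime : Prime p) {Δ : ℤ} (Δ-nonsquare : NonsquareFp p Δ) where

  open Int using (-_; _+_; _-_; _*_)
  open ModularPrime p-prime
  open QuadraticExtension p Δ public
  open CommutativeRing ring using (_≉_; 0#)

  p∤Δ : ¬ p∣ Δ
  p∤Δ p∣Δ = Δ-nonsquare (+ 0 , Signed.∣⇒∣ᵤ (p∣-≡ (zero-squared Δ) (p∣-neg p∣Δ)))
    where
    zero-squared : ∀ Δ → - Δ ≡ + 0 * + 0 - Δ
    zero-squared = solve-∀

  norm : F₂ → ℤ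
  norm (a , b) = a * a - Δ * (b * b)

  -- If b ≡ 0 then a² ≡ 0; otherwise a/b would be a square root of Δ.
  nonzero⇒p∤norm : ∀ {x} → x ≉ 0# → ¬ p∣ norm x
  nonzero⇒p∤norm {a , b} x≉0 p∣N with p∣? b
  ... | yes p∣b = x≉0 (p∣⇒≡ₚ0 p∣a , p∣⇒≡ₚ0 p∣b)
    where
    square : ∀ Δ a b → (a * a - Δ * (b * b)) + Δ * (b * b) ≡ a * a
    square = solve-∀
    p∣a : p∣ a
    p∣a = [ id , id ]′ (p∣-euclid a a (p∣-≡ (square Δ a b) (p∣-+ p∣N (p∣-*ˡ Δ (p∣-*ˡ b p∣b)))))
  ... | no p∤b with inverse p∤b
  ...   | m , p∣bm-1 = Δ-nonsquare (a * m , Signed.∣⇒∣ᵤ (p∣-≡ (square-root Δ a b m)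
            (p∣-+ (p∣-*ˡ (m * m) p∣N) (p∣-*ˡ Δ (p∣-*ʳ (b * m + + 1) p∣bm-1)))))
    where
    square-root : ∀ Δ a b m → m * m * (a * a - Δ * (b * b)) + Δ * ((b * m - + 1) * (b * m + + 1)) ≡ a * m * (a * m) - Δ
    square-root = solve-∀

  no-zero-divisors : ∀ {x y} → x ≉ 0# → mul Δ x y ≋ 0# → y ≋ 0#
  no-zero-divisors {a , b} {c , d} x≉0 (h , k) =
    p∣⇒≡ₚ0 (p∣-cancelˡ p∤N (p∣-≡ (conjugate₁ Δ a b c d) (p∣-- (p∣-*ˡ a (≡ₚ0⇒p∣ h)) (p∣-*ˡ Δ (p∣-*ˡ b (≡ₚ0⇒p∣ k)))))) ,
    p∣⇒≡ₚ0 (p∣-cancelˡ p∤N (p∣-≡ (conjugate₂ Δ a b c d) (p∣-- (p∣-*ˡ a (≡ₚ0⇒p∣ k)) (p∣-*ˡ b (≡ₚ0⇒p∣ h)))))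
    where
    p∤N : ¬ p∣ norm (a , b)
    p∤N = nonzero⇒p∤norm x≉0
    conjugate₁ : ∀ Δ a b c d → a * (a * c + Δ * (b * d)) - Δ * (b * (a * d + b * c)) ≡ (a * a - Δ * (b * b)) * c
    conjugate₁ = solve-∀
    conjugate₂ : ∀ Δ a b c d → a * (a * d + b * c) - b * (a * c + Δ * (b * d)) ≡ (a * a - Δ * (b * b)) * d
    conjugate₂ = solve-∀

module Family where

  open Int using (-_; _+_; _-_; _*_)

  A₂ B₂ : ℤ → F₂
  A₂ s = (- + 30 , + 18 * s)
  B₂ s = (+ 56 , - + 72 * s)

  jCross : ℤ → ℤ → ℤ → F₂
  jCross Δ s t = sub (mul Δ (pow Δ (A₂ t) 3) (pow Δ (B₂ s) 2)) (mul Δ (pow Δ (A₂ s) 3) (pow Δ (B₂ t) 2))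

  quartic : ℤ → ℤ → ℤ → ℤ
  quartic Δ s t = - + 4725 + + 1323 * Δ * (s * s + t * t) + + 108 * Δ * s * t + + 2187 * Δ * Δ * s * s * t * t

  -- Copies of the operations of Defs and of the definitions above over the ring solver's syntax:
  -- they evaluate to the originals definitionally, so `solve` proves identities stated with them.
  module Mirror {n : ℕ} where

    open ℤ-Syntax using (Expr; Κ; _⊕_; _⊗_; ⊝_)

    Pairᴱ : Set
    Pairᴱ = Expr ℤ n × Expr ℤ n

    infixl 6 _⊖_
    _⊖_ : Expr ℤ n → Expr ℤ n → Expr ℤ n
    x ⊖ y = x ⊕ ⊝ y

    constᴱ : ℤ → Pairᴱ
    constᴱ c = Κ c , Κ (+ 0)

    addᴱ subᴱ : Pairᴱ → Pairᴱ → Pairᴱ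
    addᴱ (a , b) (c , d) = a ⊕ c , b ⊕ d
    subᴱ (a , b) (c , d) = a ⊖ c , b ⊖ d

    mulᴱ : Expr ℤ n → Pairᴱ → Pairᴱ → Pairᴱ
    mulᴱ δ (a , b) (c , d) = a ⊗ c ⊕ δ ⊗ (b ⊗ d) , a ⊗ d ⊕ b ⊗ c

    powᴱ : Expr ℤ n → Pairᴱ → ℕ → Pairᴱ
    powᴱ δ x zero = constᴱ (+ 1)
    powᴱ δ x (suc k) = mulᴱ δ x (powᴱ δ x k)

    C₂ᴱ : Expr ℤ n → Expr ℤ n → Pairᴱ
    C₂ᴱ δ s = mulᴱ δ (constᴱ (+ 9)) (addᴱ (constᴱ (+ 1)) (mulᴱ δ (s , Κ (+ 0)) (Κ (+ 0) , Κ (+ 1))))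

    E₂ᴱ : Expr ℤ n → Expr ℤ n → Pairᴱ × Pairᴱ
    E₂ᴱ δ s = mulᴱ δ (constᴱ (+ 2)) (subᴱ (C₂ᴱ δ s) (constᴱ (+ 24))) , mulᴱ δ (constᴱ (- + 8)) (subᴱ (C₂ᴱ δ s) (constᴱ (+ 16)))

    A₂ᴱ B₂ᴱ : Expr ℤ n → Pairᴱ
    A₂ᴱ s = Κ (- + 30) , Κ (+ 18) ⊗ s
    B₂ᴱ s = Κ (+ 56) , Κ (- + 72) ⊗ s

    jCrossᴱ : Expr ℤ n → Expr ℤ n → Expr ℤ n → Pairᴱ
    jCrossᴱ δ s t = subᴱ (mulᴱ δ (powᴱ δ (A₂ᴱ t) 3) (powᴱ δ (B₂ᴱ s) 2)) (mulᴱ δ (powᴱ δ (A₂ᴱ s) 3) (powᴱ δ (B₂ᴱ t) 2))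

    quarticᴱ : Expr ℤ n → Expr ℤ n → Expr ℤ n → Expr ℤ n
    quarticᴱ δ s t =
      Κ (- + 4725) ⊕ Κ (+ 1323) ⊗ δ ⊗ (s ⊗ s ⊕ t ⊗ t) ⊕ Κ (+ 108) ⊗ δ ⊗ s ⊗ t ⊕ Κ (+ 2187) ⊗ δ ⊗ δ ⊗ s ⊗ s ⊗ t ⊗ t

  open Mirror
  open ℤ-Syntax using (solve; _⊜_; Κ; _⊕_; _⊗_)

  E₂-coefficients : ∀ Δ s → E₂ Δ s ≡ (A₂ s , B₂ s)
  E₂-coefficients Δ s = ×-≡,≡→≡ (×-≡,≡→≡ (A-re Δ s , A-im Δ s) , ×-≡,≡→≡ (B-re Δ s , B-im Δ s))
    where
    A-re : ∀ Δ s → proj₁ (proj₁ (E₂ Δ s)) ≡ - + 30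
    A-re = solve 2 (λ Δ s → proj₁ (proj₁ (E₂ᴱ Δ s)) ⊜ proj₁ (A₂ᴱ s)) refl
    A-im : ∀ Δ s → proj₂ (proj₁ (E₂ Δ s)) ≡ + 18 * s
    A-im = solve 2 (λ Δ s → proj₂ (proj₁ (E₂ᴱ Δ s)) ⊜ proj₂ (A₂ᴱ s)) refl
    B-re : ∀ Δ s → proj₁ (proj₂ (E₂ Δ s)) ≡ + 56
    B-re = solve 2 (λ Δ s → proj₁ (proj₂ (E₂ᴱ Δ s)) ⊜ proj₁ (B₂ᴱ s)) refl
    B-im : ∀ Δ s → proj₂ (proj₂ (E₂ Δ s)) ≡ - + 72 * s
    B-im = solve 2 (λ Δ s → proj₂ (proj₂ (E₂ᴱ Δ s)) ⊜ proj₂ (B₂ᴱ s)) refl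

  jCross-components : ∀ Δ s t → jCross Δ s t ≡ (+ 746496 * Δ * (t - s) * (s + t) * (+ 65 - + 63 * Δ * s * t) , + 13824 * (t - s) * quartic Δ s t)
  jCross-components Δ s t = ×-≡,≡→≡ (re Δ s t , im Δ s t)
    where
    re : ∀ Δ s t → proj₁ (jCross Δ s t) ≡ + 746496 * Δ * (t - s) * (s + t) * (+ 65 - + 63 * Δ * s * t)
    re = solve 3 (λ Δ s t → proj₁ (jCrossᴱ Δ s t)
                          ⊜ Κ (+ 746496) ⊗ Δ ⊗ (t ⊖ s) ⊗ (s ⊕ t) ⊗ (Κ (+ 65) ⊖ Κ (+ 63) ⊗ Δ ⊗ s ⊗ t)) refl
    im : ∀ Δ s t → proj₂ (jCross Δ s t) ≡ + 13824 * (t - s) * quartic Δ s t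
    im = solve 3 (λ Δ s t → proj₂ (jCrossᴱ Δ s t) ⊜ Κ (+ 13824) ⊗ (t ⊖ s) ⊗ quarticᴱ Δ s t) refl

module Classification {p : ℕ} (p-prime : Prime p) (p>3 : 3 < p) {Δ : ℤ} (Δ-nonsquare : NonsquareFp p Δ) where

  open Int using (-_; _+_; _-_; _*_)
  open ModularPrime p-prime
  open QuadraticField p-prime Δ-nonsquare
  open CommutativeRing ring using (_≉_; 0#)
  open IntegralDomain no-zero-divisors
  open Family
  open Family.Mirror
  open ℤ-Syntax using (solve; _⊜_; Κ; _⊕_; _⊗_)

  p∤2 : ¬ p∣ + 2
  p∤2 = p∤-small (ℕₚ.<-trans (ℕₚ.n<1+n 2) p>3)

  p∤3 : ¬ p∣ + 3
  p∤3 = p∤-small p>3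

  sameJ-cases : ∀ s t → ¬ p∣ (t - s) → SameJ (A₂ s , B₂ s) (A₂ t , B₂ t) →
                (p∣ (s + t) ⊎ p∣ (+ 65 - + 63 * Δ * s * t)) × p∣ quartic Δ s t
  sameJ-cases s t p∤t-s (≡ₚ-intro h₁ , ≡ₚ-intro h₂) =
    Sum.map₁ (p∣-cancelˡ (p∤-* (p∤-* (p∤-* (p∤-^ p∤2 10) (p∤-^ p∤3 6)) p∤Δ) p∤t-s))
      (p∣-euclid _ _ (p∣-≡ (cong proj₁ (jCross-components Δ s t)) h₁)) ,
    p∣-cancelˡ (p∤-* (p∤-* (p∤-^ p∤2 9) (p∤-^ p∤3 3)) p∤t-s) (p∣-≡ (cong proj₂ (jCross-components Δ s t)) h₂)

  AntipodalRoot : ℤ → Set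
  AntipodalRoot s = p∣ (+ 81 * Δ * s * s + + 175)

  ProductPair : ℤ → ℤ → Set
  ProductPair s t = p∣ (+ 65 - + 63 * Δ * s * t) × p∣ (+ 5250987 * Δ * ((s + t) * (s + t)) - + 19906560)

  antipodalRoot? : ∀ s → Dec (AntipodalRoot s)
  antipodalRoot? s = p∣? _

  productPair? : ∀ s t → Dec (ProductPair s t)
  productPair? s t = p∣? _ ×-dec p∣? _

  -- Δ s² = 1 would make Δ a square.
  antipodal⇒root : ∀ {s t} → p∣ (s + t) → p∣ quartic Δ s t → AntipodalRoot s
  antipodal⇒root {s} {t} p∣s+t p∣Q =
    [ (λ p∣Δs²-1 → ⊥-elim (Δ-nonsquare (Δ * s , Signed.∣⇒∣ᵤ (p∣-≡ (square Δ s) (p∣-*ˡ Δ p∣Δs²-1))))) , id ]′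
      (p∣-euclid _ _ (p∣-cancelˡ (p∤-^ p∤3 3) (p∣-≡ (factor Δ s t) (p∣-- p∣Q (p∣-*ʳ _ p∣s+t)))))
    where
    factor : ∀ Δ s t → quartic Δ s t - (s + t) * (+ 1323 * Δ * (t - s) + + 108 * Δ * s + + 2187 * Δ * Δ * s * s * (t - s))
                       ≡ + 27 * ((Δ * s * s - + 1) * (+ 81 * Δ * s * s + + 175))
    factor = solve 3 (λ Δ s t → quarticᴱ Δ s t
                                ⊖ (s ⊕ t) ⊗ (Κ (+ 1323) ⊗ Δ ⊗ (t ⊖ s) ⊕ Κ (+ 108) ⊗ Δ ⊗ s ⊕ Κ (+ 2187) ⊗ Δ ⊗ Δ ⊗ s ⊗ s ⊗ (t ⊖ s))
                              ⊜ Κ (+ 27) ⊗ ((Δ ⊗ s ⊗ s ⊖ Κ (+ 1)) ⊗ (Κ (+ 81) ⊗ Δ ⊗ s ⊗ s ⊕ Κ (+ 175)))) refl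
    square : ∀ Δ s → Δ * (Δ * s * s - + 1) ≡ Δ * s * (Δ * s) - Δ
    square = solve-∀

  product⇒pair : ∀ {s t} → p∣ (+ 65 - + 63 * Δ * s * t) → p∣ quartic Δ s t → ProductPair s t
  product⇒pair {s} {t} p∣65-63Δst p∣Q =
    p∣65-63Δst , p∣-≡ (eliminate Δ s t) (p∣-+ (p∣-*ˡ (+ 3969) p∣Q) (p∣-*ʳ _ p∣65-63Δst))
    where
    eliminate : ∀ Δ s t → + 3969 * quartic Δ s t + (+ 65 - + 63 * Δ * s * t) * (- + 159894 + + 2187 * (+ 63 * Δ * s * t + + 65))
                          ≡ + 5250987 * Δ * ((s + t) * (s + t)) - + 19906560
    eliminate = solve 3 (λ Δ s t → Κ (+ 3969) ⊗ quarticᴱ Δ s t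
                                   ⊕ (Κ (+ 65) ⊖ Κ (+ 63) ⊗ Δ ⊗ s ⊗ t) ⊗ (Κ (- + 159894) ⊕ Κ (+ 2187) ⊗ (Κ (+ 63) ⊗ Δ ⊗ s ⊗ t ⊕ Κ (+ 65)))
                                 ⊜ (Κ (+ 5250987) ⊗ Δ ⊗ ((s ⊕ t) ⊗ (s ⊕ t)) ⊖ Κ (+ 19906560))) refl

  root-unique-up-to-sign : ∀ {a s} → AntipodalRoot a → AntipodalRoot s → p∣ (s - a) ⊎ p∣ (s + a)
  root-unique-up-to-sign {a} {s} root-a root-s =
    p∣-euclid _ _ (p∣-cancelˡ (p∤-* (p∤-^ p∤3 4) p∤Δ) (p∣-≡ (difference Δ a s) (p∣-- root-s root-a)))
    where
    difference : ∀ Δ a s → (+ 81 * Δ * s * s + + 175) - (+ 81 * Δ * a * a + + 175) ≡ + 81 * Δ * ((s - a) * (s + a))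
    difference = solve-∀

  -- The pair is pinned down by its product s t and the square of its sum (s + t)².
  pair-unique-up-to-sign : ∀ {a b s t} → ProductPair a b → ProductPair s t →
                           p∣ (s - a) ⊎ p∣ (t - a) ⊎ p∣ (s + a) ⊎ p∣ (t + a)
  pair-unique-up-to-sign {a} {b} {s} {t} (p∣Pab , p∣Sab) (p∣Pst , p∣Sst) =
    [ same-sum , opposite-sum ]′ (p∣-euclid _ _ (p∣-cancelˡ (p∤-* (p∤-* (p∤-^ p∤3 7) (p∤-^ p∤7 4)) p∤Δ)
                                   (p∣-≡ (sum-difference Δ a b s t) (p∣-- p∣Sst p∣Sab))))
    where
    p∤63 : ¬ p∣ + 63
    p∤63 p∣63 = p∤2 (p∣-≡ (two-from-63 Δ s t) (p∣-- (p∣-- (p∣-*ʳ t (p∣-*ʳ s (p∣-*ʳ Δ p∣63))) p∣63) (p∣-neg p∣Pst)))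
      where
      two-from-63 : ∀ Δ s t → + 63 * Δ * s * t - + 63 - - (+ 65 - + 63 * Δ * s * t) ≡ + 2
      two-from-63 = solve-∀
    p∤7 : ¬ p∣ + 7
    p∤7 p∣7 = p∤63 (p∣-*ˡ (+ 9) p∣7)
    p∣st-ab : p∣ (s * t - a * b)
    p∣st-ab = p∣-cancelˡ (p∤-* p∤63 p∤Δ) (p∣-≡ (product-difference Δ a b s t) (p∣-- p∣Pab p∣Pst))
      where
      product-difference : ∀ Δ a b s t → (+ 65 - + 63 * Δ * a * b) - (+ 65 - + 63 * Δ * s * t) ≡ + 63 * Δ * (s * t - a * b)
      product-difference = solve-∀
    sum-difference : ∀ Δ a b s t → (+ 5250987 * Δ * ((s + t) * (s + t)) - + 19906560) - (+ 5250987 * Δ * ((a + b) * (a + b)) - + 19906560)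
                                 ≡ + 2187 * + 2401 * Δ * ((s + t - (a + b)) * (s + t + (a + b)))
    sum-difference = solve-∀
    same-sum : p∣ (s + t - (a + b)) → p∣ (s - a) ⊎ p∣ (t - a) ⊎ p∣ (s + a) ⊎ p∣ (t + a)
    same-sum h = [ inj₁ , (λ p∣s-b → inj₂ (inj₁ (p∣-≡ (other a b s t) (p∣-- h p∣s-b)))) ]′
                   (p∣-euclid _ _ (p∣-≡ (factor a b s t) (p∣-- (p∣-*ˡ s h) p∣st-ab)))
      where
      factor : ∀ a b s t → s * (s + t - (a + b)) - (s * t - a * b) ≡ (s - a) * (s - b)
      factor = solve-∀
      other : ∀ a b s t → (s + t - (a + b)) - (s - b) ≡ t - a
      other = solve-∀
    opposite-sum : p∣ (s + t + (a + b)) → p∣ (s - a) ⊎ p∣ (t - a) ⊎ p∣ (s + a) ⊎ p∣ (t + a)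
    opposite-sum h = [ (λ p∣s+a → inj₂ (inj₂ (inj₁ p∣s+a)))
                     , (λ p∣s+b → inj₂ (inj₂ (inj₂ (p∣-≡ (other a b s t) (p∣-- h p∣s+b))))) ]′
                       (p∣-euclid _ _ (p∣-≡ (factor a b s t) (p∣-- (p∣-*ˡ s h) p∣st-ab)))
      where
      factor : ∀ a b s t → s * (s + t + (a + b)) - (s * t - a * b) ≡ (s + a) * (s + b)
      factor = solve-∀
      other : ∀ a b s t → (s + t + (a + b)) - (s + b) ≡ t + a
      other = solve-∀

  ⟦_⟧ : Fin p → ℤ
  ⟦ s ⟧ = + toℕ s

  root-anchor : ∃ λ e → ∀ (s : Fin p) → AntipodalRoot ⟦ s ⟧ → p∣ (⟦ s ⟧ - e) ⊎ p∣ (⟦ s ⟧ + e)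
  root-anchor = anchor (Finₚ.any? (λ a → antipodalRoot? ⟦ a ⟧))
    where
    anchor : Dec (∃ λ a → AntipodalRoot ⟦ a ⟧) →
             ∃ λ e → ∀ (s : Fin p) → AntipodalRoot ⟦ s ⟧ → p∣ (⟦ s ⟧ - e) ⊎ p∣ (⟦ s ⟧ + e)
    anchor (yes (a , root-a)) = ⟦ a ⟧ , λ s → root-unique-up-to-sign {⟦ a ⟧} {⟦ s ⟧} root-a
    anchor (no no-root) = + 0 , λ s root-s → ⊥-elim (no-root (s , root-s))

  pair-anchor : ∃ λ e → ∀ (s t : Fin p) → ProductPair ⟦ s ⟧ ⟦ t ⟧ →
                p∣ (⟦ s ⟧ - e) ⊎ p∣ (⟦ t ⟧ - e) ⊎ p∣ (⟦ s ⟧ + e) ⊎ p∣ (⟦ t ⟧ + e)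
  pair-anchor = anchor (Finₚ.any? (λ a → Finₚ.any? (λ b → productPair? ⟦ a ⟧ ⟦ b ⟧)))
    where
    anchor : Dec (∃ λ a → ∃ λ b → ProductPair ⟦ a ⟧ ⟦ b ⟧) → ∃ λ e → ∀ (s t : Fin p) → ProductPair ⟦ s ⟧ ⟦ t ⟧ →
             p∣ (⟦ s ⟧ - e) ⊎ p∣ (⟦ t ⟧ - e) ⊎ p∣ (⟦ s ⟧ + e) ⊎ p∣ (⟦ t ⟧ + e)
    anchor (yes (a , b , pair-ab)) = ⟦ a ⟧ , λ s t → pair-unique-up-to-sign {⟦ a ⟧} {⟦ b ⟧} {⟦ s ⟧} {⟦ t ⟧} pair-ab
    anchor (no no-pair) = + 0 , λ s t pair-st → ⊥-elim (no-pair (s , t , pair-st))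

  e₁ e₂ : ℤ
  e₁ = proj₁ root-anchor
  e₂ = proj₁ pair-anchor

  Exceptional : ℤ → Set
  Exceptional x = p∣ (x - e₁) ⊎ p∣ (x - e₂) ⊎ p∣ (x + e₂)

  sameJ⇒exceptional : ∀ (s t : Fin p) → s ≢ t → SameJ (A₂ ⟦ s ⟧ , B₂ ⟦ s ⟧) (A₂ ⟦ t ⟧ , B₂ ⟦ t ⟧) →
                      Exceptional ⟦ s ⟧ ⊎ Exceptional ⟦ t ⟧
  sameJ⇒exceptional s t s≢t h = [ antipodal , product ]′ (proj₁ cases)
    where
    cases : (p∣ (⟦ s ⟧ + ⟦ t ⟧) ⊎ p∣ (+ 65 - + 63 * Δ * ⟦ s ⟧ * ⟦ t ⟧)) × p∣ quartic Δ ⟦ s ⟧ ⟦ t ⟧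
    cases = sameJ-cases ⟦ s ⟧ ⟦ t ⟧ (λ p∣t-s → s≢t (sym (toℕ-residue-injective t s (≡ₚ-intro p∣t-s)))) h
    other : ∀ s t e → (s + t) - (s + e) ≡ t - e
    other = solve-∀
    antipodal : p∣ (⟦ s ⟧ + ⟦ t ⟧) → Exceptional ⟦ s ⟧ ⊎ Exceptional ⟦ t ⟧
    antipodal p∣s+t =
      [ (λ p∣s-e₁ → inj₁ (inj₁ p∣s-e₁))
      , (λ p∣s+e₁ → inj₂ (inj₁ (p∣-≡ (other ⟦ s ⟧ ⟦ t ⟧ e₁) (p∣-- p∣s+t p∣s+e₁)))) ]′
        (proj₂ root-anchor s (antipodal⇒root {⟦ s ⟧} {⟦ t ⟧} p∣s+t (proj₂ cases)))
    product : p∣ (+ 65 - + 63 * Δ * ⟦ s ⟧ * ⟦ t ⟧) → Exceptional ⟦ s ⟧ ⊎ Exceptional ⟦ t ⟧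
    product p∣65-63Δst =
      [ (λ p∣s-e₂ → inj₁ (inj₂ (inj₁ p∣s-e₂))) , [ (λ p∣t-e₂ → inj₂ (inj₂ (inj₁ p∣t-e₂))) ,
      [ (λ p∣s+e₂ → inj₁ (inj₂ (inj₂ p∣s+e₂))) , (λ p∣t+e₂ → inj₂ (inj₂ (inj₂ p∣t+e₂))) ]′ ]′ ]′
        (proj₂ pair-anchor s t (product⇒pair {⟦ s ⟧} {⟦ t ⟧} p∣65-63Δst (proj₂ cases)))

  -- A₂ s or B₂ s can vanish only when p ∈ {5, 7} and p ∣ s; then s is a root of 81Δs² + 175.
  exceptional-if-p∣175 : ∀ (s : Fin p) → p∣ ⟦ s ⟧ → p∣ + 175 → Exceptional ⟦ s ⟧
  exceptional-if-p∣175 s p∣s p∣175 =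
    [ (λ p∣s-e₁ → inj₁ p∣s-e₁) , (λ p∣s+e₁ → inj₁ (p∣-≡ (other ⟦ s ⟧ e₁) (p∣-- (p∣-+ p∣s p∣s) p∣s+e₁))) ]′
      (proj₂ root-anchor s (p∣-+ (p∣-*ˡ (+ 81 * Δ * ⟦ s ⟧) p∣s) p∣175))
    where
    other : ∀ s e → (s + s) - (s + e) ≡ s - e
    other = solve-∀

  A₂-nonzero : ∀ (s : Fin p) → ¬ Exceptional ⟦ s ⟧ → A₂ ⟦ s ⟧ ≉ 0#
  A₂-nonzero s ok (p∣30 , p∣18s) = ok (exceptional-if-p∣175 s p∣s (p∣-*ˡ (+ 35) p∣5))
    where
    p∣5 : p∣ + 5
    p∣5 = p∣-cancelˡ (p∤-* p∤2 p∤3) (p∣-neg (≡ₚ0⇒p∣ p∣30))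
    p∣s : p∣ ⟦ s ⟧
    p∣s = p∣-cancelˡ (p∤-* p∤2 (p∤-^ p∤3 2)) (≡ₚ0⇒p∣ p∣18s)

  B₂-nonzero : ∀ (s : Fin p) → ¬ Exceptional ⟦ s ⟧ → B₂ ⟦ s ⟧ ≉ 0#
  B₂-nonzero s ok (p∣56 , p∣72s) = ok (exceptional-if-p∣175 s p∣s (p∣-*ˡ (+ 25) p∣7))
    where
    p∣7 : p∣ + 7
    p∣7 = p∣-cancelˡ (p∤-^ p∤2 3) (≡ₚ0⇒p∣ p∣56)
    p∣s : p∣ ⟦ s ⟧
    p∣s = p∣-cancelˡ (λ p∣-72 → p∤-* (p∤-^ p∤2 3) (p∤-^ p∤3 2) (p∣-neg p∣-72)) (≡ₚ0⇒p∣ p∣72s)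

  at-most-one-residue : ∀ c → AtMostOne (λ (x : Fin p) → p∣ (⟦ x ⟧ + c))
  at-most-one-residue c {x} {y} hx hy = toℕ-residue-injective x y (≡ₚ-intro (p∣-≡ (cancel ⟦ x ⟧ ⟦ y ⟧ c) (p∣-- hx hy)))
    where
    cancel : ∀ x y c → (x + c) - (y + c) ≡ x - y
    cancel = solve-∀

  selection : ∃ λ (f : Fin (p ∸ 3) → Fin p) → Injective _≡_ _≡_ f × ∀ i → ¬ Exceptional ⟦ f i ⟧
  selection = avoid₃ (λ x → p∣? (⟦ x ⟧ - e₁)) (λ x → p∣? (⟦ x ⟧ - e₂)) (λ x → p∣? (⟦ x ⟧ + e₂))
                     (at-most-one-residue (- e₁)) (at-most-one-residue (- e₂)) (at-most-one-residue e₂)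

  sameJ⇒≡ : ∀ (s t : Fin p) → ¬ Exceptional ⟦ s ⟧ → ¬ Exceptional ⟦ t ⟧ → SameJ (E₂F Δ s) (E₂F Δ t) → s ≡ t
  sameJ⇒≡ s t s-ok t-ok h = decidable-stable (s Finₚ.≟ t) λ s≢t →
    [ s-ok , t-ok ]′ (sameJ⇒exceptional s t s≢t (subst₂ SameJ (E₂-coefficients Δ ⟦ s ⟧) (E₂-coefficients Δ ⟦ t ⟧) h))

  iso⇒≡ : ∀ (s t : Fin p) → ¬ Exceptional ⟦ s ⟧ → ¬ Exceptional ⟦ t ⟧ → Iso p Δ (E₂F Δ s) (E₂F Δ t) → s ≡ t
  iso⇒≡ s t s-ok t-ok iso = sameJ⇒≡ s t s-ok t-ok (≅⇒sameJ {E₂F Δ s} {E₂F Δ t} (iso⇒≅ iso))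

  module _ {d : F₂} (d-nonsquare : NonsquareFp² p Δ d) where

    ¬□d : ¬ IsSquare d
    ¬□d = nonsquare⇒¬IsSquare d-nonsquare

    E₂±≡twistIf : ∀ (x : Fin p × Bool) → E₂± Δ d x ≡ twistIf (proj₂ x) d (E₂F Δ (proj₁ x))
    E₂±≡twistIf (s , false) = refl
    E₂±≡twistIf (s , true) = refl

    twisted-iso⇒≡ : ∀ (x y : Fin p × Bool) → ¬ Exceptional ⟦ proj₁ x ⟧ → ¬ Exceptional ⟦ proj₁ y ⟧ →
                    Iso p Δ (E₂± Δ d x) (E₂± Δ d y) → x ≡ y
    twisted-iso⇒≡ (s , β) (t , β′) s-ok t-ok iso =
      ×-≡,≡→≡ (s≡t , twistIf-≅⇒≡ β β′ ¬□d A≉0 B≉0 (subst (λ t → twistIf β d (E₂F Δ s) ≅ twistIf β′ d (E₂F Δ t)) (sym s≡t) ≅′))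
      where
      ≅′ : twistIf β d (E₂F Δ s) ≅ twistIf β′ d (E₂F Δ t)
      ≅′ = subst₂ _≅_ (E₂±≡twistIf (s , β)) (E₂±≡twistIf (t , β′)) (iso⇒≅ {E₂± Δ d (s , β)} {E₂± Δ d (t , β′)} iso)
      s≡t : s ≡ t
      s≡t = sameJ⇒≡ s t s-ok t-ok (sameJ-untwist β β′ {E₂F Δ s} {E₂F Δ t} (nonsquare⇒nonzero ¬□d) (≅⇒sameJ ≅′))
      A≉0 : proj₁ (E₂F Δ s) ≉ 0#
      A≉0 = subst (λ E → proj₁ E ≉ 0#) (sym (E₂-coefficients Δ ⟦ s ⟧)) (A₂-nonzero s s-ok)
      B≉0 : proj₂ (E₂F Δ s) ≉ 0#
      B≉0 = subst (λ E → proj₂ E ≉ 0#) (sym (E₂-coefficients Δ ⟦ s ⟧)) (B₂-nonzero s s-ok)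

proposition3 : (p : ℕ) → Prime p → 3 < p → (Δ : ℤ) → NonsquareFp p Δ →
    (∃ λ (f : Fin (p ∸ 3) → Fin p) →
       ∀ i j → i ≢ j → ¬ Iso p Δ (E₂F Δ (f i)) (E₂F Δ (f j)))
    × ((d : F₂) → NonsquareFp² p Δ d →
       ∃ λ (g : Fin (2 ℕ.* p ∸ 6) → Fin p × Bool) →
         ∀ i j → i ≢ j → ¬ Iso p Δ (E₂± Δ d (g i)) (E₂± Δ d (g j)))
proposition3 p p-prime p>3 Δ Δ-nonsquare =
  (f , λ i j i≢j iso → i≢j (f-injective (iso⇒≡ (f i) (f j) (f-ok i) (f-ok j) iso))) ,
  λ d d-nonsquare → g , λ i j i≢j iso → i≢j (g-injective (twisted-iso⇒≡ d-nonsquare (g i) (g j) (g-ok i) (g-ok j) iso))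
  where
  open Classification p-prime p>3 Δ-nonsquare
  f : Fin (p ∸ 3) → Fin p
  f = proj₁ selection
  f-injective : Injective _≡_ _≡_ f
  f-injective = proj₁ (proj₂ selection)
  f-ok : ∀ i → ¬ Exceptional ⟦ f i ⟧
  f-ok = proj₂ (proj₂ selection)
  index : Fin (2 ℕ.* p ∸ 6) → Fin (p ∸ 3) × Bool
  index = tagged (2*n∸6≡n∸3+n∸3 p)
  g : Fin (2 ℕ.* p ∸ 6) → Fin p × Bool
  g i = Prod.map₁ f (index i)
  g-ok : ∀ i → ¬ Exceptional ⟦ proj₁ (g i) ⟧
  g-ok i = f-ok (proj₁ (index i))
  g-injective : Injective _≡_ _≡_ g
  g-injective eq = tagged-injective (2*n∸6≡n∸3+n∸3 p) (×-≡,≡→≡ (f-injective (cong proj₁ eq) , cong proj₂ eq))
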